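{- For all nonnegative integers $d$, all integers $k\ge1$ and all integers $n$, $$p^{(d)}_k(n)=p^{(d)}_{k-1}(n-1,\,d+1)+p^{(d)}_k(n-k).$$
   Context: A partition of an integer $m$ into $k$ parts is a weakly decreasing sequence of $k$ positive integers summing to $m$. For a nonnegative integer $d$, the parts are called $d$-distant if any two parts differ by at least $d$. $p^{(d)}_k(m)$ denotes the number of partitions of $m$ into exactly $k$ $d$-distant parts, and $p^{(d)}_k(m,r)$ denotes the number of such partitions whose smallest part is at least $r$. Conventions: $p^{(d)}_0(m)=p^{(d)}_0(m,r)=1$ if $m=0$ and $0$ otherwise; all these counts are $0$ when $m<0$. -}

module Defs where

open import Data.Nat using (ℕ; zero; suc; _+_; _≤_; _<_; _≟_; _≤?_)
open import Data.Nat.Properties using ()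
open import Data.Fin using (Fin; toℕ)
import Data.Fin as F
open import Data.Fin.Properties using (all?)
open import Data.Vec using (Vec; []; _∷_; lookup; sum)
open import Data.List using (List; []; _∷_; length; filter; concatMap; map)
open import Data.Integer using (ℤ; +_; -[1+_])
open import Data.Product using (_×_)
open import Relation.Nullary using (Dec; _×-dec_)
open import Relation.Nullary.Decidable using (_→-dec_)
open import Relation.Binary.PropositionalEquality using (_≡_)

-- A partition into k parts is represented as a vector (x₀,…,x_{k-1}) of parts.
-- "Weakly decreasing" and "d-distant" together: for positions i < j,
-- x_j + d ≤ x_i  (for d = 0 this is just weak decrease).
Distant : ℕ → ∀ {k} → Vec ℕ k → Set
Distant d {k} v = ∀ (i j : Fin k) → F._<_ i j → lookup v j + d ≤ lookup v i

AllGeq : ℕ → ∀ {k} → Vec ℕ k → Set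
AllGeq r {k} v = ∀ (i : Fin k) → r ≤ lookup v i

IsDistPartition : (d m r : ℕ) → ∀ {k} → Vec ℕ k → Set
IsDistPartition d m r v = (sum v ≡ m) × AllGeq 1 v × AllGeq r v × Distant d v

isDistPartition? : (d m r : ℕ) → ∀ {k} (v : Vec ℕ k) → Dec (IsDistPartition d m r v)
isDistPartition? d m r v =
  (sum v ≟ m)
  ×-dec all? (λ i → 1 ≤? lookup v i)
  ×-dec all? (λ i → r ≤? lookup v i)
  ×-dec all? (λ i → all? (λ j → (toℕ i Data.Nat.<? toℕ j) →-dec ((lookup v j + d) ≤? lookup v i)))

range : ℕ → List ℕ
range zero = 0 ∷ []
range (suc m) = 0 ∷ map suc (range m)

-- all vectors of length k with entries in {0,…,m} (a finite superset of the candidates)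
candidates : (k m : ℕ) → List (Vec ℕ k)
candidates zero m = [] ∷ []
candidates (suc k) m = concatMap (λ x → map (x ∷_) (candidates k m)) (range m)

countℕ : (d k m r : ℕ) → ℕ
countℕ d k m r = length (filter (isDistPartition? d m r) (candidates k m))

-- p^{(d)}_k(m, r), for integer m (0 when m < 0)
pr : (d k : ℕ) → ℤ → (r : ℕ) → ℕ
pr d k (+ m) r = countℕ d k m r
pr d k -[1+ _ ] r = 0

p : (d k : ℕ) → ℤ → ℕ
p d k (+ m) = length (filter (λ v → (sum v ≟ m) ×-dec all? (λ i → 1 ≤? lookup v i)
                                     ×-dec all? (λ i → all? (λ j → (toℕ i Data.Nat.<? toℕ j) →-dec ((lookup v j + d) ≤? lookup v i))))
                             (candidates k m))
p d k -[1+ _ ] = 0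

-- A d-distant partition either has smallest part 1, or all its parts are at
-- least 2.  Deleting the smallest part 1 leaves k - 1 parts of total n - 1, all
-- at least d + 1 (they exceed that part by d); lowering every part by 1 leaves a
-- d-distant partition of n - k into k positive parts.  Both maps are bijections
-- onto the respective classes, so the two counts add up to p⁽ᵈ⁾ₖ(n).
module Submission where

open import Defs
open import Level using (0ℓ)
open import Data.Nat as ℕ using (ℕ; zero; suc; _+_; _∸_; _≤_; z≤n; s≤s; s≤s⁻¹; _≟_; _≤?_)
open import Data.Nat.Properties
  using (+-identityʳ; +-assoc; +-suc; +-comm; ≤-trans; m≤m+n; m≤n+m; m+n≤o⇒m≤o; <-irrefl; suc-injective)
open import Data.Integer as ℤ using (ℤ; +_) renaming (_-_ to _-ℤ_)
open import Data.Integer.Properties using (+-0-abelianGroup; pos-+; +-injective)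
open import Algebra.Properties.AbelianGroup +-0-abelianGroup using (//-rightDividesˡ; //-rightDividesʳ)
open import Data.Fin as Fin using (toℕ)
open import Data.Fin.Properties using (all?)
open import Data.Vec as Vec using (Vec; []; _∷_; lookup; sum; _∷ʳ_; initLast)
open import Data.Vec.Properties using (∷-injective; ∷ʳ-injectiveˡ)
open import Data.Vec.Relation.Unary.All as All using (All; []; _∷_)
import Data.Vec.Relation.Unary.All.Properties as Allₚ
open import Data.Vec.Relation.Unary.AllPairs as AllPairs using (AllPairs; []; _∷_)
import Data.Vec.Relation.Unary.AllPairs.Properties as AllPairsₚ
open import Data.List as List using (List; []; _∷_; length; filter; concatMap; cartesianProductWith; _++_)
open import Data.List.Properties using (length-map; length-++)
open import Data.List.Relation.Unary.All as ListAll using ([]; _∷_)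
open import Data.List.Relation.Unary.AllPairs using ([]; _∷_)
import Data.List.Relation.Unary.All.Properties as ListAllₚ
open import Data.List.Membership.Propositional using (_∈_)
open import Data.List.Membership.Propositional.Properties
  using (∈-map⁺; ∈-map⁻; ∈-++⁺ˡ; ∈-++⁺ʳ; ∈-++⁻; ∈-filter⁺; ∈-filter⁻; ∈-cartesianProductWith⁺; ∈-cartesianProductWith⁻)
open import Data.List.Membership.Propositional.Properties.WithK using (unique∧set⇒bag)
open import Data.List.Relation.Unary.Any using (here; there)
open import Data.List.Relation.Unary.Unique.Propositional using (Unique)
import Data.List.Relation.Unary.Unique.Propositional.Properties as Uniqueₚ
open import Data.List.Relation.Binary.Disjoint.Propositional using (Disjoint)
open import Data.List.Relation.Binary.BagAndSetEquality using (∼bag⇒↭)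
open import Data.List.Relation.Binary.Permutation.Propositional.Properties using (↭-length)
open import Data.Product using (_×_; _,_; proj₁; proj₂; ∃-syntax)
open import Data.Sum using (_⊎_; inj₁; inj₂)
open import Function using (_∘_; Injective)
open import Function.Bundles using (_⇔_; mk⇔; Equivalence)
open import Function.Construct.Composition using (_⇔-∘_)
open import Relation.Nullary using (Dec; _×-dec_)
open import Relation.Nullary.Decidable using (_→-dec_)
open import Relation.Unary using (Pred; Decidable)
open import Relation.Binary.PropositionalEquality
  using (_≡_; refl; sym; trans; cong; cong₂; subst; module ≡-Reasoning)

open Equivalence using (to; from)

private
  variable
    A B C : Set
    k m n r : ℕ

Vec-map-injective : {f : A → B} → Injective _≡_ _≡_ f → Injective _≡_ _≡_ (λ (xs : Vec A n) → Vec.map f xs)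
Vec-map-injective _ {[]} {[]} _ = refl
Vec-map-injective f-inj {x ∷ xs} {y ∷ ys} eq with ∷-injective eq
... | fx≡fy , fxs≡fys = cong₂ _∷_ (f-inj fx≡fy) (Vec-map-injective f-inj fxs≡fys)

All-∷ʳ⁺ : {P : Pred A 0ℓ} {xs : Vec A n} {y : A} → All P xs → P y → All P (xs ∷ʳ y)
All-∷ʳ⁺ [] py = py ∷ []
All-∷ʳ⁺ (px ∷ pxs) py = px ∷ All-∷ʳ⁺ pxs py

All-∷ʳ⁻ : {P : Pred A 0ℓ} (xs : Vec A n) {y : A} → All P (xs ∷ʳ y) → All P xs × P y
All-∷ʳ⁻ [] (py ∷ []) = [] , py
All-∷ʳ⁻ (x ∷ xs) (px ∷ pxs) = let pxs′ , py = All-∷ʳ⁻ xs pxs in px ∷ pxs′ , py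

module _ {R : A → A → Set} where

  AllPairs-∷ʳ⁺ : {xs : Vec A n} {y : A} → AllPairs R xs → All (λ x → R x y) xs → AllPairs R (xs ∷ʳ y)
  AllPairs-∷ʳ⁺ [] [] = [] ∷ []
  AllPairs-∷ʳ⁺ (rx ∷ rxs) (rxy ∷ rxsy) = All-∷ʳ⁺ rx rxy ∷ AllPairs-∷ʳ⁺ rxs rxsy

  AllPairs-∷ʳ⁻ : (xs : Vec A n) {y : A} → AllPairs R (xs ∷ʳ y) → AllPairs R xs × All (λ x → R x y) xs
  AllPairs-∷ʳ⁻ [] _ = [] , []
  AllPairs-∷ʳ⁻ (x ∷ xs) (rx ∷ rxs) =
    let rx′ , rxy = All-∷ʳ⁻ xs rx
        rxs′ , rxsy = AllPairs-∷ʳ⁻ xs rxs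
    in rx′ ∷ rxs′ , rxy ∷ rxsy

  AllPairs-map⁻ : {f : B → A} {xs : Vec B n} → AllPairs R (Vec.map f xs) → AllPairs (λ x y → R (f x) (f y)) xs
  AllPairs-map⁻ {xs = []} [] = []
  AllPairs-map⁻ {xs = x ∷ xs} (rx ∷ rxs) = Allₚ.map⁻ rx ∷ AllPairs-map⁻ rxs

  AllPairs-lookup⁺ : {xs : Vec A n} → AllPairs R xs → ∀ i j → i Fin.< j → R (lookup xs i) (lookup xs j)
  AllPairs-lookup⁺ (rx ∷ _) Fin.zero (Fin.suc j) _ = Allₚ.lookup⁺ rx j
  AllPairs-lookup⁺ (_ ∷ rxs) (Fin.suc i) (Fin.suc j) i<j = AllPairs-lookup⁺ rxs i j (s≤s⁻¹ i<j)

  AllPairs-lookup⁻ : {xs : Vec A n} → (∀ i j → i Fin.< j → R (lookup xs i) (lookup xs j)) → AllPairs R xs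
  AllPairs-lookup⁻ {xs = []} _ = []
  AllPairs-lookup⁻ {xs = x ∷ xs} r =
    Allₚ.lookup⁻ (λ j → r Fin.zero (Fin.suc j) (s≤s z≤n)) ∷
    AllPairs-lookup⁻ (λ i j i<j → r (Fin.suc i) (Fin.suc j) (s≤s i<j))

sum-∷ʳ : (xs : Vec ℕ n) (y : ℕ) → sum (xs ∷ʳ y) ≡ sum xs + y
sum-∷ʳ [] y = +-identityʳ y
sum-∷ʳ (x ∷ xs) y = trans (cong (_+_ x) (sum-∷ʳ xs y)) (sym (+-assoc x (sum xs) y))

sum-map-suc : (xs : Vec ℕ n) → sum (Vec.map suc xs) ≡ sum xs + n
sum-map-suc [] = refl
sum-map-suc {suc n} (x ∷ xs) = begin
  suc x + sum (Vec.map suc xs)  ≡⟨ cong (_+_ (suc x)) (sum-map-suc xs) ⟩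
  suc (x + (sum xs + n))        ≡⟨ cong suc (+-assoc x (sum xs) n) ⟨
  suc (x + sum xs + n)          ≡⟨ +-suc (x + sum xs) n ⟨
  x + sum xs + suc n            ∎
  where open ≡-Reasoning

All-≤-sum : (xs : Vec ℕ n) → All (_≤ sum xs) xs
All-≤-sum [] = []
All-≤-sum (x ∷ xs) = m≤m+n x (sum xs) ∷ All.map (λ y≤ → ≤-trans y≤ (m≤n+m (sum xs) x)) (All-≤-sum xs)

All-suc≤⇒map-suc : {xs : Vec ℕ n} → All (suc r ≤_) xs → ∃[ ys ] All (r ≤_) ys × Vec.map suc ys ≡ xs
All-suc≤⇒map-suc [] = [] , [] , refl
All-suc≤⇒map-suc (s≤s r≤x ∷ r<xs) with All-suc≤⇒map-suc r<xs
... | ys , r≤ys , refl = _ ∷ ys , r≤x ∷ r≤ys , refl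

i≡j-k⇔i+k≡j : ∀ i j k → i ≡ j -ℤ k ⇔ i ℤ.+ k ≡ j
i≡j-k⇔i+k≡j i j k = mk⇔
  (λ i≡j-k → trans (cong (ℤ._+ k) i≡j-k) (//-rightDividesˡ k j))
  (λ i+k≡j → trans (sym (//-rightDividesʳ k i)) (cong (_-ℤ k) i+k≡j))

+m≡i-+n⇔+[m+n]≡i : ∀ m n i → + m ≡ i -ℤ + n ⇔ + (m + n) ≡ i
+m≡i-+n⇔+[m+n]≡i m n i = subst (λ j → (+ m ≡ i -ℤ + n) ⇔ (j ≡ i)) (sym (pos-+ m n)) (i≡j-k⇔i+k≡j (+ m) i (+ n))

range-unique : ∀ m → Unique (range m)
range-unique zero = [] ∷ []
range-unique (suc m) =
  ListAllₚ.map⁺ (ListAll.universal (λ _ ()) (range m)) ∷ Uniqueₚ.map⁺ suc-injective (range-unique m)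

∈-range⁺ : ∀ m {x} → x ≤ m → x ∈ range m
∈-range⁺ zero z≤n = here refl
∈-range⁺ (suc m) z≤n = here refl
∈-range⁺ (suc m) (s≤s x≤m) = there (∈-map⁺ suc (∈-range⁺ m x≤m))

∈-range⁻ : ∀ m {x} → x ∈ range m → x ≤ m
∈-range⁻ zero (here refl) = z≤n
∈-range⁻ (suc m) (here refl) = z≤n
∈-range⁻ (suc m) (there x∈) with ∈-map⁻ suc x∈
... | y , y∈ , refl = s≤s (∈-range⁻ m y∈)

concatMap-map≡cartesianProductWith : (f : A → B → C) (xs : List A) (ys : List B) →
  concatMap (λ x → List.map (f x) ys) xs ≡ cartesianProductWith f xs ys
concatMap-map≡cartesianProductWith f [] ys = refl
concatMap-map≡cartesianProductWith f (x ∷ xs) ys =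
  cong (List.map (f x) ys ++_) (concatMap-map≡cartesianProductWith f xs ys)

candidates-suc : ∀ k m → candidates (suc k) m ≡ cartesianProductWith _∷_ (range m) (candidates k m)
candidates-suc k m = concatMap-map≡cartesianProductWith _∷_ (range m) (candidates k m)

candidates-unique : ∀ k m → Unique (candidates k m)
candidates-unique zero m = [] ∷ []
candidates-unique (suc k) m rewrite candidates-suc k m =
  Uniqueₚ.cartesianProductWith⁺ _∷_ ∷-injective (range-unique m) (candidates-unique k m)

∈-candidates⁺ : ∀ m {v : Vec ℕ k} → All (_≤ m) v → v ∈ candidates k m
∈-candidates⁺ m [] = here refl
∈-candidates⁺ {suc k} m (x≤m ∷ v≤m) rewrite candidates-suc k m =
  ∈-cartesianProductWith⁺ _∷_ (∈-range⁺ m x≤m) (∈-candidates⁺ m v≤m)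

∈-candidates⁻ : ∀ k m {v : Vec ℕ k} → v ∈ candidates k m → All (_≤ m) v
∈-candidates⁻ zero m {[]} _ = []
∈-candidates⁻ (suc k) m v∈ rewrite candidates-suc k m
  with ∈-cartesianProductWith⁻ _∷_ (range m) (candidates k m) v∈
... | x , u , x∈ , u∈ , refl = ∈-range⁻ m x∈ ∷ ∈-candidates⁻ k m u∈

-- Every vector summing to m has its entries in {0,…,m}, so filtering the
-- candidates by a predicate that fixes the sum loses nothing.
∈-filter-candidates⇔ : {P : Pred (Vec ℕ k) 0ℓ} (P? : Decidable P) →
  (∀ {v} → P v → sum v ≡ m) → ∀ {v} → v ∈ filter P? (candidates k m) ⇔ P v
∈-filter-candidates⇔ {k} {m} P? sum≡m {v} = mk⇔
  (proj₂ ∘ ∈-filter⁻ P? {xs = candidates k m})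
  (λ Pv → ∈-filter⁺ P? (∈-candidates⁺ m (subst (λ s → All (_≤ s) v) (sum≡m Pv) (All-≤-sum v))) Pv)

Spaced : ℕ → ℕ → ℕ → Set
Spaced d x y = y + d ≤ x

IsDistantPartition : ℕ → ℤ → Vec ℕ k → Set
IsDistantPartition d n v = + sum v ≡ n × All (1 ≤_) v × AllPairs (Spaced d) v

-- The filter in the definition of p, so that length-partitions holds by refl.
isPositiveDistant? : (d m : ℕ) (v : Vec ℕ k) → Dec (sum v ≡ m × AllGeq 1 v × Distant d v)
isPositiveDistant? d m v =
  (sum v ≟ m)
  ×-dec all? (λ i → 1 ≤? lookup v i)
  ×-dec all? (λ i → all? (λ j → (toℕ i ℕ.<? toℕ j) →-dec ((lookup v j + d) ≤? lookup v i)))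

positiveDistant⇔ : ∀ d {v : Vec ℕ k} → (sum v ≡ m × AllGeq 1 v × Distant d v) ⇔ IsDistantPartition d (+ m) v
positiveDistant⇔ d = mk⇔
  (λ (s , pos , dist) → cong +_ s , Allₚ.lookup⁻ pos , AllPairs-lookup⁻ dist)
  (λ (s , pos , dist) → +-injective s , Allₚ.lookup⁺ pos , AllPairs-lookup⁺ dist)

isDistPartition⇔ : ∀ d {v : Vec ℕ k} → IsDistPartition d m r v ⇔ (IsDistantPartition d (+ m) v × All (r ≤_) v)
isDistPartition⇔ d = mk⇔
  (λ (s , pos , r≤ , dist) → (cong +_ s , Allₚ.lookup⁻ pos , AllPairs-lookup⁻ dist) , Allₚ.lookup⁻ r≤)
  (λ ((s , pos , dist) , r≤) → +-injective s , Allₚ.lookup⁺ pos , Allₚ.lookup⁺ r≤ , AllPairs-lookup⁺ dist)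

partitions : (d k : ℕ) → ℤ → List (Vec ℕ k)
partitions d k (+ m) = filter (isPositiveDistant? d m) (candidates k m)
partitions d k ℤ.-[1+ _ ] = []

partitionsFrom : (d k : ℕ) → ℤ → ℕ → List (Vec ℕ k)
partitionsFrom d k (+ m) r = filter (isDistPartition? d m r) (candidates k m)
partitionsFrom d k ℤ.-[1+ _ ] r = []

length-partitions : ∀ d k n → length (partitions d k n) ≡ p d k n
length-partitions d k (+ m) = refl
length-partitions d k ℤ.-[1+ _ ] = refl

length-partitionsFrom : ∀ d k n r → length (partitionsFrom d k n r) ≡ pr d k n r
length-partitionsFrom d k (+ m) r = refl
length-partitionsFrom d k ℤ.-[1+ _ ] r = refl

partitions-unique : ∀ d k n → Unique (partitions d k n)
partitions-unique d k (+ m) = Uniqueₚ.filter⁺ (isPositiveDistant? d m) (candidates-unique k m)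
partitions-unique d k ℤ.-[1+ _ ] = []

partitionsFrom-unique : ∀ d k n r → Unique (partitionsFrom d k n r)
partitionsFrom-unique d k (+ m) r = Uniqueₚ.filter⁺ (isDistPartition? d m r) (candidates-unique k m)
partitionsFrom-unique d k ℤ.-[1+ _ ] r = []

∈-partitions⇔ : ∀ d k n {v} → v ∈ partitions d k n ⇔ IsDistantPartition d n v
∈-partitions⇔ d k (+ m) = positiveDistant⇔ d ⇔-∘ ∈-filter-candidates⇔ (isPositiveDistant? d m) proj₁
∈-partitions⇔ d k ℤ.-[1+ _ ] = mk⇔ (λ ()) (λ { (() , _) })

∈-partitionsFrom⇔ : ∀ d k n r {v} → v ∈ partitionsFrom d k n r ⇔ (IsDistantPartition d n v × All (r ≤_) v)
∈-partitionsFrom⇔ d k (+ m) r = isDistPartition⇔ d ⇔-∘ ∈-filter-candidates⇔ (isDistPartition? d m r) proj₁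
∈-partitionsFrom⇔ d k ℤ.-[1+ _ ] r = mk⇔ (λ ()) (λ { ((() , _) , _) })

-- The smallest part of a distant partition is its last entry.
endsInOne⊎allAtLeastTwo : ∀ {d} (v : Vec ℕ (suc k)) → All (1 ≤_) v → AllPairs (Spaced d) v →
  (∃[ w ] v ≡ w ∷ʳ 1) ⊎ All (2 ≤_) v
endsInOne⊎allAtLeastTwo v pos dist with initLast v
... | w , zero , refl with () ← proj₂ (All-∷ʳ⁻ w pos)
... | w , 1 , refl = inj₁ (w , refl)
... | w , suc (suc y) , refl = inj₂ (All-∷ʳ⁺ (All.map 2≤y+d⇒2≤x (proj₂ (AllPairs-∷ʳ⁻ w dist))) 2≤y)
  where
  2≤y = s≤s (s≤s z≤n)
  2≤y+d⇒2≤x = λ {x} y+d≤x → ≤-trans 2≤y (m+n≤o⇒m≤o (suc (suc y)) {o = x} y+d≤x)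

appendOne⇔ : ∀ d n (w : Vec ℕ k) →
  IsDistantPartition d n (w ∷ʳ 1) ⇔ (IsDistantPartition d (n -ℤ + 1) w × All (d + 1 ≤_) w)
appendOne⇔ d n w = mk⇔
  (λ (s , pos , dist) →
    let dist′ , spaced = AllPairs-∷ʳ⁻ w dist in
    ( from (+m≡i-+n⇔+[m+n]≡i (sum w) 1 n) (trans (cong +_ (sym (sum-∷ʳ w 1))) s)
    , proj₁ (All-∷ʳ⁻ w pos) , dist′ )
    , All.map (λ {x} → subst (_≤ x) (+-comm 1 d)) spaced)
  (λ ((s , pos , dist) , d+1≤) →
    trans (cong +_ (sum-∷ʳ w 1)) (to (+m≡i-+n⇔+[m+n]≡i (sum w) 1 n) s)
    , All-∷ʳ⁺ pos (s≤s z≤n)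
    , AllPairs-∷ʳ⁺ dist (All.map (λ {x} → subst (_≤ x) (+-comm d 1)) d+1≤))

lowerAll⇔ : ∀ d n (u : Vec ℕ k) →
  (IsDistantPartition d n (Vec.map suc u) × All (1 ≤_) u) ⇔ IsDistantPartition d (n -ℤ + k) u
lowerAll⇔ {k} d n u = mk⇔
  (λ ((s , _ , dist) , pos) →
    from (+m≡i-+n⇔+[m+n]≡i (sum u) k n) (trans (cong +_ (sym (sum-map-suc u))) s)
    , pos , AllPairs.map s≤s⁻¹ (AllPairs-map⁻ dist))
  (λ (s , pos , dist) →
    ( trans (cong +_ (sum-map-suc u)) (to (+m≡i-+n⇔+[m+n]≡i (sum u) k n) s)
    , Allₚ.map⁺ (All.universal (λ _ → s≤s z≤n) u) , AllPairsₚ.map⁺ (AllPairs.map s≤s dist) )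
    , pos)

module Split (d k : ℕ) (n : ℤ) where

  endingInOne : List (Vec ℕ (suc k))
  endingInOne = List.map (_∷ʳ 1) (partitionsFrom d k (n -ℤ + 1) (d + 1))

  atLeastTwo : List (Vec ℕ (suc k))
  atLeastTwo = List.map (Vec.map suc) (partitions d (suc k) (n -ℤ + suc k))

  ∈-split⁺ : ∀ {v} → v ∈ partitions d (suc k) n → v ∈ endingInOne ++ atLeastTwo
  ∈-split⁺ {v} v∈ with to (∈-partitions⇔ d (suc k) n) v∈
  ... | isP@(_ , pos , dist) with endsInOne⊎allAtLeastTwo v pos dist
  ... | inj₁ (w , refl) =
    ∈-++⁺ˡ (∈-map⁺ (_∷ʳ 1) (from (∈-partitionsFrom⇔ d k _ _) (to (appendOne⇔ d n w) isP)))
  ... | inj₂ parts≥2 with All-suc≤⇒map-suc parts≥2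
  ... | u , pos′ , refl =
    ∈-++⁺ʳ endingInOne (∈-map⁺ (Vec.map suc) (from (∈-partitions⇔ d (suc k) _) (to (lowerAll⇔ d n u) (isP , pos′))))

  ∈-split⁻ : ∀ {v} → v ∈ endingInOne ++ atLeastTwo → v ∈ partitions d (suc k) n
  ∈-split⁻ v∈ with ∈-++⁻ endingInOne v∈
  ... | inj₁ v∈₁ with ∈-map⁻ (_∷ʳ 1) v∈₁
  ...   | w , w∈ , refl =
    from (∈-partitions⇔ d (suc k) n) (from (appendOne⇔ d n w) (to (∈-partitionsFrom⇔ d k _ _) w∈))
  ∈-split⁻ v∈ | inj₂ v∈₂ with ∈-map⁻ (Vec.map suc) v∈₂
  ...   | u , u∈ , refl =
    from (∈-partitions⇔ d (suc k) n) (proj₁ (from (lowerAll⇔ d n u) (to (∈-partitions⇔ d (suc k) _) u∈)))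

  length-endingInOne : length endingInOne ≡ pr d k (n -ℤ + 1) (d + 1)
  length-endingInOne = trans (length-map (_∷ʳ 1) (partitionsFrom d k (n -ℤ + 1) (d + 1)))
                             (length-partitionsFrom d k (n -ℤ + 1) (d + 1))

  length-atLeastTwo : length atLeastTwo ≡ p d (suc k) (n -ℤ + suc k)
  length-atLeastTwo = trans (length-map (Vec.map suc) (partitions d (suc k) (n -ℤ + suc k)))
                            (length-partitions d (suc k) (n -ℤ + suc k))

  split-unique : Unique (endingInOne ++ atLeastTwo)
  split-unique = Uniqueₚ.++⁺
    (Uniqueₚ.map⁺ (λ {w} {w′} → ∷ʳ-injectiveˡ w w′) (partitionsFrom-unique d k (n -ℤ + 1) (d + 1)))
    (Uniqueₚ.map⁺ (Vec-map-injective suc-injective) (partitions-unique d (suc k) (n -ℤ + suc k)))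
    disjoint
    where
    disjoint : Disjoint endingInOne atLeastTwo
    disjoint (v∈₁ , v∈₂) with ∈-map⁻ (_∷ʳ 1) v∈₁ | ∈-map⁻ (Vec.map suc) v∈₂
    ... | w , _ , refl | u , u∈ , w∷ʳ1≡u+1 =
      let pos = proj₁ (proj₂ (to (∈-partitions⇔ d (suc k) (n -ℤ + suc k)) u∈))
          parts≥2 = subst (All (2 ≤_)) (sym w∷ʳ1≡u+1) (Allₚ.map⁺ (All.map s≤s pos))
      in <-irrefl refl (proj₂ (All-∷ʳ⁻ w parts≥2))

unique∧set⇒length≡ : {xs ys : List A} → Unique xs → Unique ys → (∀ {x} → x ∈ xs ⇔ x ∈ ys) → length xs ≡ length ys
unique∧set⇒length≡ uxs uys xs∼ys = ↭-length (∼bag⇒↭ (unique∧set⇒bag uxs uys xs∼ys))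

proposition4 : (d k : ℕ) → 1 ≤ k → (n : ℤ) →
    p d k n ≡ pr d (k ∸ 1) (n -ℤ + 1) (d + 1) + p d k (n -ℤ + k)
proposition4 d zero () n
proposition4 d (suc k) _ n = begin
  p d (suc k) n
    ≡⟨ length-partitions d (suc k) n ⟨
  length (partitions d (suc k) n)
    ≡⟨ unique∧set⇒length≡ (partitions-unique d (suc k) n) split-unique (mk⇔ ∈-split⁺ ∈-split⁻) ⟩
  length (endingInOne ++ atLeastTwo)
    ≡⟨ length-++ endingInOne ⟩
  length endingInOne + length atLeastTwo
    ≡⟨ cong₂ _+_ length-endingInOne length-atLeastTwo ⟩
  pr d k (n -ℤ + 1) (d + 1) + p d (suc k) (n -ℤ + suc k)
    ∎
  where
  open ≡-Reasoning
  open Split d k n
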